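{- Let $X\in\{\,\text{(empty)},\mathrm N,\mathrm T,\mathrm W,\mathrm C,\mathrm A,\mathrm{NA}\}$, and let $\mathsf{G.N}X$ and $\mathsf{H.N}X$ be the corresponding sequent and hypersequent calculi. For every formula $A$, if the sequent $\Rightarrow A$ is derivable in $\mathsf{G.N}X$, then the hypersequent $\Rightarrow A$ is derivable in $\mathsf{H.N}X$.
   Context: Language: formulas $A ::= p \mid \bot \mid A\to A \mid A \preccurlyeq A$ over countably many atoms; $\top$ defined as usual. Sequent calculi. Sequents $\Gamma\Rightarrow\Delta$: $\Gamma,\Delta$ finite multisets of formulas. Rules (write $\Sigma^{\preccurlyeq}$ for $C_1\preccurlyeq D_1,\dots,C_n\preccurlyeq D_n$; $\Gamma^{\preccurlyeq}$, $\Delta^{\preccurlyeq}$ for the $\preccurlyeq$-formulas in $\Gamma$, $\Delta$): init: $\Gamma,p\Rightarrow p,\Delta$; $\bot_L$: $\Gamma,\bot\Rightarrow\Delta$; $\to_L$: from $\Gamma\Rightarrow A,\Delta$ and $\Gamma,B\Rightarrow\Delta$ infer $\Gamma,A\to B\Rightarrow\Delta$; $\to_R$: from $\Gamma,A\Rightarrow B,\Delta$ infer $\Gamma\Rightarrow A\to B,\Delta$. $\mathrm{CP}_n$: from $\{C_k\Rightarrow A,D_1,\dots,D_{k-1}\}_{1\le k\le n}$ and $B\Rightarrow A,D_1,\dots,D_n$ infer $\Gamma,\Sigma^{\preccurlyeq}\Rightarrow A\preccurlyeq B,\Delta$. $\mathrm N_n$: from $\{C_k\Rightarrow D_1,\dots,D_{k-1}\}_{k\le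 n}$ and $\Rightarrow D_1,\dots,D_n$ infer $\Gamma,\Sigma^{\preccurlyeq}\Rightarrow\Delta$. $\mathrm T_n$: from $\{C_k\Rightarrow D_1,\dots,D_{k-1}\}_{k\le n}$ and $\Gamma,\Sigma^{\preccurlyeq}\Rightarrow D_1,\dots,D_n,\Delta$ infer $\Gamma,\Sigma^{\preccurlyeq}\Rightarrow\Delta$. $\mathrm W_n$: from $\{C_k\Rightarrow A,D_1,\dots,D_{k-1}\}_{k\le n}$ and $\Gamma,\Sigma^{\preccurlyeq}\Rightarrow A,A\preccurlyeq B,D_1,\dots,D_n,\Delta$ infer $\Gamma,\Sigma^{\preccurlyeq}\Rightarrow A\preccurlyeq B,\Delta$. $\mathrm W_0$: from $\Gamma\Rightarrow A\preccurlyeq B,A,\Delta$ infer $\Gamma\Rightarrow A\preccurlyeq B,\Delta$. $\mathrm C_0$: from $\Gamma,A\preccurlyeq B,A\Rightarrow\Delta$ and $\Gamma,A\preccurlyeq B\Rightarrow B,\Delta$ infer $\Gamma,A\preccurlyeq B\Rightarrow\Delta$. $\mathrm A_n$: from $\{\Gamma^{\preccurlyeq},\Sigma^{\preccurlyeq},C_k\Rightarrow A\preccurlyeq B,A,D_1,\dots,D_{k-1},\Delta^{\preccurlyeq}\}_{k\le n}$ and $\Gamma^{\preccurlyeq},\Sigma^{\preccurlyeq},B\Rightarrow A\preccurlyeq B,A,D_1,\dots,D_n,\Delta^{\preccurlyeq}$ infer $\Gamma,\Sigma^{\preccurlyeq}\Rightarrow A\preccurlyeq B,\Delta$. $\mathrm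 N^A_n$: from $\{\Gamma^{\preccurlyeq},\Sigma^{\preccurlyeq},C_k\Rightarrow D_1,\dots,D_{k-1},\Delta^{\preccurlyeq}\}_{k\le n}$ and $\Gamma^{\preccurlyeq},\Sigma^{\preccurlyeq}\Rightarrow D_1,\dots,D_n,\Delta^{\preccurlyeq}$ infer $\Gamma,\Sigma^{\preccurlyeq}\Rightarrow\Delta$. $\mathsf{G.N}=\{\mathrm{init},\bot_L,\to_L,\to_R\}\cup\{\mathrm{CP}_n\mid n\ge0\}$; $\mathsf{G.NN}=\mathsf{G.N}\cup\{\mathrm N_n\mid n\ge1\}$; $\mathsf{G.NT}=\mathsf{G.N}\cup\{\mathrm T_n\mid n\ge1\}$; $\mathsf{G.NW}=\mathsf{G.N}\cup\{\mathrm W_n\mid n\ge0\}\cup\{\mathrm T_n\mid n\ge1\}$; $\mathsf{G.NC}=\mathsf{G.N}\cup\{\mathrm W_0,\mathrm C_0\}$; $\mathsf{G.NA}=\{\mathrm{init},\bot_L,\to_L,\to_R\}\cup\{\mathrm A_n\mid n\ge0\}$; $\mathsf{G.NNA}=\mathsf{G.NA}\cup\{\mathrm N^A_n\mid n\ge1\}$. Hypersequent calculi. A block $[\Sigma\lhd A]$: finite multiset $\Sigma$ of formulas and formula $A$; a sequent with blocks $\Gamma\Rightarrow\Delta$: $\Gamma$ finite multiset of formulas, $\Delta$ finite multiset of formulas and blocks; a hypersequent: finite multiset $\Gamma_1\Rightarrow\Delta_1\mid\dots\mid\Gamma_n\Rightarrow\Delta_n$ of such. Rules ($\mathcal G$ =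 other components): init: $\mathcal G\mid\Gamma,p\Rightarrow p,\Delta$; $\bot_L$: $\mathcal G\mid\Gamma,\bot\Rightarrow\Delta$; $\to_L$: from $\mathcal G\mid\Gamma,A\to B,B\Rightarrow\Delta$ and $\mathcal G\mid\Gamma,A\to B\Rightarrow\Delta,A$ infer $\mathcal G\mid\Gamma,A\to B\Rightarrow\Delta$; $\to_R$: from $\mathcal G\mid\Gamma,A\Rightarrow\Delta,A\to B,B$ infer $\mathcal G\mid\Gamma\Rightarrow\Delta,A\to B$; $\preccurlyeq_L$: from $\mathcal G\mid\Gamma,A\preccurlyeq B\Rightarrow\Delta,[B,\Sigma\lhd C]$ and $\mathcal G\mid\Gamma,A\preccurlyeq B\Rightarrow\Delta,[\Sigma\lhd C],[\Sigma\lhd A]$ infer $\mathcal G\mid\Gamma,A\preccurlyeq B\Rightarrow\Delta,[\Sigma\lhd C]$; $\preccurlyeq_R$: from $\mathcal G\mid\Gamma\Rightarrow\Delta,A\preccurlyeq B,[A\lhd B]$ infer $\mathcal G\mid\Gamma\Rightarrow\Delta,A\preccurlyeq B$; jp: from $\mathcal G\mid\Gamma\Rightarrow\Delta,[\Sigma\lhd A]\mid A\Rightarrow\Sigma$ infer $\mathcal G\mid\Gamma\Rightarrow\Delta,[\Sigma\lhd A]$; N: from $\mathcal G\mid\Gamma\Rightarrow\Delta,[\bot\lhd\top]$ infer $\mathcal G\mid\Gamma\Rightarrow\Delta$; T: from $\mathcal G\mid\Gamma,A\preccurlyeq B\Rightarrow\Delta,B$ and $\mathcal G\mid\Gamma,A\preccurlyeq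 B\Rightarrow\Delta,[\bot\lhd A]$ infer $\mathcal G\mid\Gamma,A\preccurlyeq B\Rightarrow\Delta$; W: from $\mathcal G\mid\Gamma\Rightarrow\Delta,[\Sigma\lhd A],\Sigma$ infer $\mathcal G\mid\Gamma\Rightarrow\Delta,[\Sigma\lhd A]$; C: from $\mathcal G\mid\Gamma,A\preccurlyeq B\Rightarrow\Delta,B$ and $\mathcal G\mid\Gamma,A\preccurlyeq B,A\Rightarrow\Delta$ infer $\mathcal G\mid\Gamma,A\preccurlyeq B\Rightarrow\Delta$; $\mathrm A_L$: from $\mathcal G\mid\Gamma,A\preccurlyeq B\Rightarrow\Delta\mid\Omega,A\preccurlyeq B\Rightarrow\Theta$ infer $\mathcal G\mid\Gamma,A\preccurlyeq B\Rightarrow\Delta\mid\Omega\Rightarrow\Theta$; $\mathrm A_R$: from $\mathcal G\mid\Gamma\Rightarrow\Delta,A\preccurlyeq B\mid\Omega\Rightarrow\Theta,A\preccurlyeq B$ infer $\mathcal G\mid\Gamma\Rightarrow\Delta,A\preccurlyeq B\mid\Omega\Rightarrow\Theta$. $\mathsf{H.N}=\{\mathrm{init},\bot_L,\to_L,\to_R,\preccurlyeq_L,\preccurlyeq_R,\mathrm{jp}\}$; $\mathsf{H.NN}=\mathsf{H.N}+$N; $\mathsf{H.NT}=\mathsf{H.N}+$T; $\mathsf{H.NW}=\mathsf{H.N}+$T,W; $\mathsf{H.NC}=\mathsf{H.N}+$W,C; $\mathsf{H.NA}=\mathsf{H.N}+\mathrm A_L,\mathrm A_R$; $\mathsf{H.NNA}=\mathsf{H.NN}+\mathrm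 A_L,\mathrm A_R$. -}

module Defs where

open import Data.Nat using (ℕ)
open import Data.List using (List; []; _∷_; _++_; map; [_])
open import Data.Product using (_×_; _,_; proj₁; proj₂)
open import Data.Unit using (⊤; tt)
open import Data.Empty using (⊥)
open import Data.List.Relation.Unary.All using (All)
open import Data.List.Relation.Binary.Permutation.Propositional using (_↭_)

infixr 6 _⇒_
infix 7 _≼_

data Formula : Set where
  atom : ℕ → Formula
  falsum : Formula
  _⇒_ : Formula → Formula → Formula
  _≼_ : Formula → Formula → Formula

verum : Formula
verum = falsum ⇒ falsum

data Ext : Set where
  `E `N `T `W `C `A `NA : Ext

-- Sequent calculi G.NX
-- Multisets are represented by lists; the exchange rule `exG` makes
-- derivability invariant under permutation, i.e. sequents are
-- effectively pairs of multisets.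

Sequent : Set
Sequent = List Formula × List Formula

Sig : List (Formula × Formula) → List Formula
Sig ps = map (λ q → proj₁ q ≼ proj₂ q) ps

Ds : List (Formula × Formula) → List Formula
Ds ps = map proj₂ ps

stairs : List Formula → List (Formula × Formula) → List (Formula × List Formula)
stairs acc [] = []
stairs acc ((C , D) ∷ ps) = (C , acc) ∷ stairs (acc ++ [ D ]) ps

boxes : List Formula → List Formula
boxes [] = []
boxes (atom x ∷ Γ) = boxes Γ
boxes (falsum ∷ Γ) = boxes Γ
boxes ((A ⇒ B) ∷ Γ) = boxes Γ
boxes ((A ≼ B) ∷ Γ) = (A ≼ B) ∷ boxes Γ

gCP gN gT gW gW0 gC0 gA gNA : Ext → Set
gCP `A = ⊥
gCP `NA = ⊥
gCP _ = ⊤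
gN `N = ⊤
gN _ = ⊥
gT `T = ⊤
gT `W = ⊤
gT _ = ⊥
gW `W = ⊤
gW _ = ⊥
gW0 `C = ⊤
gW0 _ = ⊥
gC0 `C = ⊤
gC0 _ = ⊥
gA `A = ⊤
gA `NA = ⊤
gA _ = ⊥
gNA `NA = ⊤
gNA _ = ⊥

data GDer (X : Ext) : Sequent → Set where
  exG  : ∀ {Γ Γ′ Δ Δ′} → Γ ↭ Γ′ → Δ ↭ Δ′ → GDer X (Γ , Δ) → GDer X (Γ′ , Δ′)
  init : ∀ {Γ Δ p} → GDer X (atom p ∷ Γ , atom p ∷ Δ)
  botL : ∀ {Γ Δ} → GDer X (falsum ∷ Γ , Δ)
  impL : ∀ {Γ Δ A B} → GDer X (Γ , A ∷ Δ) → GDer X (B ∷ Γ , Δ) →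
         GDer X ((A ⇒ B) ∷ Γ , Δ)
  impR : ∀ {Γ Δ A B} → GDer X (A ∷ Γ , B ∷ Δ) → GDer X (Γ , (A ⇒ B) ∷ Δ)
  CP   : ∀ {Γ Δ A B} (ps : List (Formula × Formula)) → gCP X →
         All (λ q → GDer X ([ proj₁ q ] , A ∷ proj₂ q)) (stairs [] ps) →
         GDer X ([ B ] , A ∷ Ds ps) →
         GDer X (Sig ps ++ Γ , (A ≼ B) ∷ Δ)
  Nn   : ∀ {Γ Δ} (p : Formula × Formula) (ps : List (Formula × Formula)) → gN X →
         All (λ q → GDer X ([ proj₁ q ] , proj₂ q)) (stairs [] (p ∷ ps)) →
         GDer X ([] , Ds (p ∷ ps)) →
         GDer X (Sig (p ∷ ps) ++ Γ , Δ)
  Tn   : ∀ {Γ Δ} (p : Formula × Formula) (ps : List (Formula × Formula)) → gT X →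
         All (λ q → GDer X ([ proj₁ q ] , proj₂ q)) (stairs [] (p ∷ ps)) →
         GDer X (Sig (p ∷ ps) ++ Γ , Ds (p ∷ ps) ++ Δ) →
         GDer X (Sig (p ∷ ps) ++ Γ , Δ)
  Wn   : ∀ {Γ Δ A B} (ps : List (Formula × Formula)) → gW X →
         All (λ q → GDer X ([ proj₁ q ] , A ∷ proj₂ q)) (stairs [] ps) →
         GDer X (Sig ps ++ Γ , A ∷ (A ≼ B) ∷ Ds ps ++ Δ) →
         GDer X (Sig ps ++ Γ , (A ≼ B) ∷ Δ)
  W0   : ∀ {Γ Δ A B} → gW0 X →
         GDer X (Γ , (A ≼ B) ∷ A ∷ Δ) → GDer X (Γ , (A ≼ B) ∷ Δ)
  C0   : ∀ {Γ Δ A B} → gC0 X →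
         GDer X ((A ≼ B) ∷ A ∷ Γ , Δ) → GDer X ((A ≼ B) ∷ Γ , B ∷ Δ) →
         GDer X ((A ≼ B) ∷ Γ , Δ)
  An   : ∀ {Γ Δ A B} (ps : List (Formula × Formula)) → gA X →
         All (λ q → GDer X (boxes Γ ++ Sig ps ++ [ proj₁ q ] ,
                            (A ≼ B) ∷ A ∷ proj₂ q ++ boxes Δ)) (stairs [] ps) →
         GDer X (boxes Γ ++ Sig ps ++ [ B ] , (A ≼ B) ∷ A ∷ Ds ps ++ boxes Δ) →
         GDer X (Sig ps ++ Γ , (A ≼ B) ∷ Δ)
  NAn  : ∀ {Γ Δ} (p : Formula × Formula) (ps : List (Formula × Formula)) → gNA X →
         All (λ q → GDer X (boxes Γ ++ Sig (p ∷ ps) ++ [ proj₁ q ] ,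
                            proj₂ q ++ boxes Δ)) (stairs [] (p ∷ ps)) →
         GDer X (boxes Γ ++ Sig (p ∷ ps) , Ds (p ∷ ps) ++ boxes Δ) →
         GDer X (Sig (p ∷ ps) ++ Γ , Δ)

-- Hypersequent calculi H.NX
-- Multisets (antecedents, succedents, block contents, components) are
-- lists; exchange rules make derivability permutation-invariant.

data Item : Set where
  fm  : Formula → Item
  blk : List Formula → Formula → Item      -- blk Σ A  =  [Σ ◁ A]

Component : Set
Component = List Formula × List Item

Hypersequent : Set
Hypersequent = List Component

hN hT hW hC hA : Ext → Set
hN `N = ⊤
hN `NA = ⊤
hN _ = ⊥
hT `T = ⊤
hT `W = ⊤
hT _ = ⊥
hW `W = ⊤
hW `C = ⊤
hW _ = ⊥
hC `C = ⊤
hC _ = ⊥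
hA `A = ⊤
hA `NA = ⊤
hA _ = ⊥

data HDer (X : Ext) : Hypersequent → Set where
  exH  : ∀ {G G′} → G ↭ G′ → HDer X G → HDer X G′
  exL  : ∀ {G Γ Γ′ Δ} → Γ ↭ Γ′ → HDer X ((Γ , Δ) ∷ G) → HDer X ((Γ′ , Δ) ∷ G)
  exR  : ∀ {G Γ Δ Δ′} → Δ ↭ Δ′ → HDer X ((Γ , Δ) ∷ G) → HDer X ((Γ , Δ′) ∷ G)
  exB  : ∀ {G Γ Δ Σ Σ′ A} → Σ ↭ Σ′ →
         HDer X ((Γ , blk Σ A ∷ Δ) ∷ G) → HDer X ((Γ , blk Σ′ A ∷ Δ) ∷ G)
  init : ∀ {G Γ Δ p} → HDer X ((atom p ∷ Γ , fm (atom p) ∷ Δ) ∷ G)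
  botL : ∀ {G Γ Δ} → HDer X ((falsum ∷ Γ , Δ) ∷ G)
  impL : ∀ {G Γ Δ A B} →
         HDer X (((A ⇒ B) ∷ B ∷ Γ , Δ) ∷ G) →
         HDer X (((A ⇒ B) ∷ Γ , fm A ∷ Δ) ∷ G) →
         HDer X (((A ⇒ B) ∷ Γ , Δ) ∷ G)
  impR : ∀ {G Γ Δ A B} →
         HDer X ((A ∷ Γ , fm (A ⇒ B) ∷ fm B ∷ Δ) ∷ G) →
         HDer X ((Γ , fm (A ⇒ B) ∷ Δ) ∷ G)
  ≼L   : ∀ {G Γ Δ Σ A B C} →
         HDer X (((A ≼ B) ∷ Γ , blk (B ∷ Σ) C ∷ Δ) ∷ G) →
         HDer X (((A ≼ B) ∷ Γ , blk Σ C ∷ blk Σ A ∷ Δ) ∷ G) →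
         HDer X (((A ≼ B) ∷ Γ , blk Σ C ∷ Δ) ∷ G)
  ≼R   : ∀ {G Γ Δ A B} →
         HDer X ((Γ , fm (A ≼ B) ∷ blk [ A ] B ∷ Δ) ∷ G) →
         HDer X ((Γ , fm (A ≼ B) ∷ Δ) ∷ G)
  jp   : ∀ {G Γ Δ Σ A} →
         HDer X ((Γ , blk Σ A ∷ Δ) ∷ ([ A ] , map fm Σ) ∷ G) →
         HDer X ((Γ , blk Σ A ∷ Δ) ∷ G)
  Nr   : ∀ {G Γ Δ} → hN X →
         HDer X ((Γ , blk [ falsum ] verum ∷ Δ) ∷ G) →
         HDer X ((Γ , Δ) ∷ G)
  Tr   : ∀ {G Γ Δ A B} → hT X →
         HDer X (((A ≼ B) ∷ Γ , fm B ∷ Δ) ∷ G) →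
         HDer X (((A ≼ B) ∷ Γ , blk [ falsum ] A ∷ Δ) ∷ G) →
         HDer X (((A ≼ B) ∷ Γ , Δ) ∷ G)
  Wr   : ∀ {G Γ Δ Σ A} → hW X →
         HDer X ((Γ , blk Σ A ∷ map fm Σ ++ Δ) ∷ G) →
         HDer X ((Γ , blk Σ A ∷ Δ) ∷ G)
  Cr   : ∀ {G Γ Δ A B} → hC X →
         HDer X (((A ≼ B) ∷ Γ , fm B ∷ Δ) ∷ G) →
         HDer X (((A ≼ B) ∷ A ∷ Γ , Δ) ∷ G) →
         HDer X (((A ≼ B) ∷ Γ , Δ) ∷ G)
  AL   : ∀ {G Γ Δ Ω Θ A B} → hA X →
         HDer X (((A ≼ B) ∷ Γ , Δ) ∷ ((A ≼ B) ∷ Ω , Θ) ∷ G) →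
         HDer X (((A ≼ B) ∷ Γ , Δ) ∷ (Ω , Θ) ∷ G)
  AR   : ∀ {G Γ Δ Ω Θ A B} → hA X →
         HDer X ((Γ , fm (A ≼ B) ∷ Δ) ∷ (Ω , fm (A ≼ B) ∷ Θ) ∷ G) →
         HDer X ((Γ , fm (A ≼ B) ∷ Δ) ∷ (Ω , Θ) ∷ G)

{-# OPTIONS --safe #-}
-- The stair-shaped premisses of
-- CP_n, N_n, T_n, W_n, A_n and N^A_n all come from applying ≼L to the
-- formulas C_k ≼ D_k of Σ^≼ in turn: one branch adds D_k to the current
-- block, the other opens the block [Σ ◁ C_k], which jp turns into the new
-- component C_k ⇒ Σ, i.e. the k-th premiss. The sequent rules discard their
-- contexts Γ, Δ while H.NX has no weakening rule, so the induction hypothesis HDerᵂ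
-- says that a sequent is derivable under every weakening and next to any
-- other components. For A_n and N^A_n the boxed contexts Γ^≼, Δ^≼ of the
-- premisses are copied into the new component by A_L and A_R.
module Submission where

open import Defs
open import Data.List using (List; []; _∷_; [_]; _++_; map)
import Data.List.Properties as Listₚ
open import Data.List.Relation.Unary.All using (All; []; _∷_)
import Data.List.Relation.Unary.All.Properties as Allₚ
open import Data.List.Relation.Binary.Permutation.Propositional
open import Data.List.Relation.Binary.Permutation.Propositional.Properties
  using (++⁺ˡ; ++⁺ʳ; ++⁺; shift; shifts; map⁺; ++-comm; ++-identityʳ)
open import Data.Product using (∃; _×_; _,_; proj₁; proj₂)
open import Data.Unit using (tt)
open import Relation.Binary.PropositionalEquality using (_≡_; refl; sym; cong; subst; module ≡-Reasoning)

infix 4 _⊑_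

_⊑_ : {A : Set} → List A → List A → Set
xs ⊑ ys = ∃ λ rest → xs ++ rest ↭ ys

module _ {A : Set} where

  ⊑-reflexive : {xs ys : List A} → xs ↭ ys → xs ⊑ ys
  ⊑-reflexive {xs} p = [] , ↭-trans (++-identityʳ xs) p

  ⊑-refl : {xs : List A} → xs ⊑ xs
  ⊑-refl = ⊑-reflexive ↭-refl

  ⊑-trans : {xs ys zs : List A} → xs ⊑ ys → ys ⊑ zs → xs ⊑ zs
  ⊑-trans {xs} (R , p) (S , q) =
    R ++ S , ↭-trans (↭-reflexive (sym (Listₚ.++-assoc xs R S))) (↭-trans (++⁺ʳ S p) q)

  []⊑ : {ys : List A} → [] ⊑ ys
  []⊑ {ys} = ys , ↭-refl

  ∷⁺ : {x : A} {xs ys : List A} → xs ⊑ ys → x ∷ xs ⊑ x ∷ ys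
  ∷⁺ {x} (R , p) = R , prep x p

  ⊑-skips : {xs ys : List A} (zs : List A) → xs ⊑ ys → xs ⊑ zs ++ ys
  ⊑-skips {xs} zs (R , p) = zs ++ R , ↭-trans (shifts xs zs) (++⁺ˡ zs p)

  ⊑-skip : {x : A} {xs ys : List A} → xs ⊑ ys → xs ⊑ x ∷ ys
  ⊑-skip {x} = ⊑-skips [ x ]

  ⊑-extend : {xs : List A} (zs : List A) → xs ⊑ xs ++ zs
  ⊑-extend zs = zs , ↭-refl

  ++⊑⇒ˡ : {xs ys zs : List A} → xs ++ ys ⊑ zs → xs ⊑ zs
  ++⊑⇒ˡ {xs} {ys} (R , p) = ys ++ R , ↭-trans (↭-reflexive (sym (Listₚ.++-assoc xs ys R))) p

  ++⊑⇒ʳ : {xs ys zs : List A} → xs ++ ys ⊑ zs → ys ⊑ zs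
  ++⊑⇒ʳ {xs} {ys} (R , p) =
    xs ++ R , ↭-trans (shifts ys xs) (↭-trans (↭-reflexive (sym (Listₚ.++-assoc xs ys R))) p)

  ∷⊑⇒ : {x : A} {xs ys : List A} → x ∷ xs ⊑ ys → xs ⊑ ys
  ∷⊑⇒ {x} = ++⊑⇒ʳ {xs = [ x ]}

  ∷⊑-split : {x : A} {xs ys : List A} → x ∷ xs ⊑ ys → ∃ λ r → ys ↭ x ∷ r
  ∷⊑-split {xs = xs} (R , p) = xs ++ R , ↭-sym p

  ⊑-++⁺ : {a b c d : List A} → a ⊑ b → c ⊑ d → a ++ c ⊑ b ++ d
  ⊑-++⁺ {a} {b} {c} {d} (R , p) (S , q) =
    R ++ S , ↭-trans (↭-reflexive (Listₚ.++-assoc a c (R ++ S)))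
               (↭-trans (++⁺ˡ a (shifts c R))
               (↭-trans (↭-reflexive (sym (Listₚ.++-assoc a R (c ++ S)))) (++⁺ p q)))

⊑-map⁺ : {A B : Set} (f : A → B) {xs ys : List A} → xs ⊑ ys → map f xs ⊑ map f ys
⊑-map⁺ f {xs} (R , p) = map f R , ↭-trans (↭-reflexive (sym (Listₚ.map-++ f xs R))) (map⁺ f p)

boxes-++ : ∀ Γ Δ → boxes (Γ ++ Δ) ≡ boxes Γ ++ boxes Δ
boxes-++ [] Δ = refl
boxes-++ (atom x ∷ Γ) Δ = boxes-++ Γ Δ
boxes-++ (falsum ∷ Γ) Δ = boxes-++ Γ Δ
boxes-++ ((A ⇒ B) ∷ Γ) Δ = boxes-++ Γ Δ
boxes-++ ((A ≼ B) ∷ Γ) Δ = cong ((A ≼ B) ∷_) (boxes-++ Γ Δ)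

boxes-Sig : ∀ ps → boxes (Sig ps) ≡ Sig ps
boxes-Sig [] = refl
boxes-Sig ((C , D) ∷ ps) = cong ((C ≼ D) ∷_) (boxes-Sig ps)

boxes-Sig-++ : ∀ Γ ps → boxes Γ ++ Sig ps ↭ boxes (Sig ps ++ Γ)
boxes-Sig-++ Γ ps = begin
  boxes Γ ++ Sig ps          ↭⟨ ++-comm (boxes Γ) (Sig ps) ⟩
  Sig ps ++ boxes Γ          ≡⟨ cong (_++ boxes Γ) (sym (boxes-Sig ps)) ⟩
  boxes (Sig ps) ++ boxes Γ  ≡⟨ sym (boxes-++ (Sig ps) Γ) ⟩
  boxes (Sig ps ++ Γ)        ∎
  where open PermutationReasoning

boxes-Sig-++-∷ʳ : ∀ Γ ps C → boxes Γ ++ Sig ps ++ [ C ] ↭ boxes (Sig ps ++ Γ) ++ [ C ]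
boxes-Sig-++-∷ʳ Γ ps C =
  ↭-trans (↭-reflexive (sym (Listₚ.++-assoc (boxes Γ) (Sig ps) [ C ]))) (++⁺ʳ [ C ] (boxes-Sig-++ Γ ps))

stairs-++ : ∀ acc xs ys → stairs acc (xs ++ ys) ≡ stairs acc xs ++ stairs (acc ++ Ds xs) ys
stairs-++ acc [] ys = cong (λ acc′ → stairs acc′ ys) (sym (Listₚ.++-identityʳ acc))
stairs-++ acc ((C , D) ∷ xs) ys =
  cong ((C , acc) ∷_)
    (subst (λ acc′ → stairs (acc ++ [ D ]) (xs ++ ys) ≡ stairs (acc ++ [ D ]) xs ++ stairs acc′ ys)
      (Listₚ.++-assoc acc [ D ] (Ds xs)) (stairs-++ (acc ++ [ D ]) xs ys))

All-stairs-∷ : ∀ ps acc x {P Q : Formula × List Formula → Set} →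
  (∀ C l → P (C , l) → Q (C , x ∷ l)) → All P (stairs acc ps) → All Q (stairs (x ∷ acc) ps)
All-stairs-∷ [] acc x f [] = []
All-stairs-∷ ((C , D) ∷ ps) acc x f (p ∷ ps′) = f C acc p ∷ All-stairs-∷ ps (acc ++ [ D ]) x f ps′

gN⇒hN : ∀ {X} → gN X → hN X
gN⇒hN {`N} _ = tt

gNA⇒hN : ∀ {X} → gNA X → hN X
gNA⇒hN {`NA} _ = tt

gT⇒hT : ∀ {X} → gT X → hT X
gT⇒hT {`T} _ = tt
gT⇒hT {`W} _ = tt

gW⇒hW : ∀ {X} → gW X → hW X
gW⇒hW {`W} _ = tt

gW0⇒hW : ∀ {X} → gW0 X → hW X
gW0⇒hW {`C} _ = tt

gC0⇒hC : ∀ {X} → gC0 X → hC X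
gC0⇒hC {`C} _ = tt

gA⇒hA : ∀ {X} → gA X → hA X
gA⇒hA {`A} _ = tt
gA⇒hA {`NA} _ = tt

gNA⇒hA : ∀ {X} → gNA X → hA X
gNA⇒hA {`NA} _ = tt

module Translation (X : Ext) where

  swap₁₂ : ∀ {c d G} → HDer X (c ∷ d ∷ G) → HDer X (d ∷ c ∷ G)
  swap₁₂ {c} {d} = exH (swap c d ↭-refl)

  exL₂ : ∀ {c Γ Γ′ Δ G} → Γ ↭ Γ′ → HDer X (c ∷ (Γ , Δ) ∷ G) → HDer X (c ∷ (Γ′ , Δ) ∷ G)
  exL₂ p d = swap₁₂ (exL p (swap₁₂ d))

  exR₂ : ∀ {c Γ Δ Δ′ G} → Δ ↭ Δ′ → HDer X (c ∷ (Γ , Δ) ∷ G) → HDer X (c ∷ (Γ , Δ′) ∷ G)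
  exR₂ p d = swap₁₂ (exR p (swap₁₂ d))

  focusˡ : ∀ {x xs Γ Δ G} → x ∷ xs ⊑ Γ →
    (∀ {r} → xs ⊑ r → HDer X ((x ∷ r , Δ) ∷ G)) → HDer X ((Γ , Δ) ∷ G)
  focusˡ (R , p) k = exL p (k (⊑-extend R))

  focusʳ : ∀ {x xs Γ Δ G} → x ∷ xs ⊑ Δ →
    (∀ {r} → xs ⊑ r → HDer X ((Γ , x ∷ r) ∷ G)) → HDer X ((Γ , Δ) ∷ G)
  focusʳ (R , p) k = exR p (k (⊑-extend R))

  HDerᵂ : Sequent → Set
  HDerᵂ (Γ , Δ) = ∀ {G Γ′ Δ′} → Γ ⊑ Γ′ → map fm Δ ⊑ Δ′ → HDer X ((Γ′ , Δ′) ∷ G)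

  HDerᵂ-weaken : ∀ {Γ Γ′ Δ Δ′} → Γ ⊑ Γ′ → Δ ⊑ Δ′ → HDerᵂ (Γ , Δ) → HDerᵂ (Γ′ , Δ′)
  HDerᵂ-weaken wΓ wΔ d wΓ′ wΔ′ = d (⊑-trans wΓ wΓ′) (⊑-trans (⊑-map⁺ fm wΔ) wΔ′)

  SideDer : List Formula → List Item → Hypersequent → Formula × List Formula → Set
  SideDer Γ Δ G (C , l) = ∀ {Δ′} → Δ ⊑ Δ′ → HDer X ((Γ , Δ′) ∷ ([ C ] , map fm l) ∷ G)

  HDerᵂ⇒SideDer : ∀ {Γ Δ G C l l′} → l ⊑ l′ → HDerᵂ ([ C ] , l) → SideDer Γ Δ G (C , l′)
  HDerᵂ⇒SideDer w d _ = swap₁₂ (d ⊑-refl (⊑-map⁺ fm w))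

  jp-HDerᵂ : ∀ {G Γ Δ Σ C l} → HDerᵂ ([ C ] , l) → l ⊑ Σ → HDer X ((Γ , blk Σ C ∷ Δ) ∷ G)
  jp-HDerᵂ d w = jp (HDerᵂ⇒SideDer w d ⊑-refl)

  unfold-≼L : ∀ ps acc {Γ Δ G E} → Sig ps ⊑ Γ → All (SideDer Γ Δ G) (stairs acc ps) →
    (∀ {Σ} → Σ ↭ acc ++ Ds ps → HDer X ((Γ , blk Σ E ∷ Δ) ∷ G)) →
    ∀ {Σ} → Σ ↭ acc → HDer X ((Γ , blk Σ E ∷ Δ) ∷ G)
  unfold-≼L [] acc _ [] close e = close (↭-trans e (↭-sym (++-identityʳ acc)))
  unfold-≼L ((C , D) ∷ ps) acc {Γ} {Δ} {G} {E} w (side ∷ sides) close {Σ} e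
    with ∷⊑-split w
  ... | _ , e′ = exL (↭-sym e′) (≼L (exL e′ grown) (exL e′ (exR (swap _ _ ↭-refl) (jp spawned))))
    where
    grown : HDer X ((Γ , blk (D ∷ Σ) E ∷ Δ) ∷ G)
    grown = unfold-≼L ps (acc ++ [ D ]) (∷⊑⇒ w) sides
      (λ e″ → close (↭-trans e″ (↭-reflexive (Listₚ.++-assoc acc [ D ] (Ds ps)))))
      (↭-trans (prep D e) (↭-sym (++-comm acc [ D ])))
    spawned : HDer X ((Γ , blk Σ C ∷ blk Σ E ∷ Δ) ∷ ([ C ] , map fm Σ) ∷ G)
    spawned = exR₂ (map⁺ fm (↭-sym e)) (side (⊑-skips (blk Σ C ∷ blk Σ E ∷ []) ⊑-refl))

  ≼R-unfold : ∀ ps {Γ Δ G A B} → Sig ps ⊑ Γ →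
    All (SideDer Γ (fm (A ≼ B) ∷ Δ) G) (stairs [ A ] ps) →
    (∀ {Σ} → Σ ↭ A ∷ Ds ps → HDer X ((Γ , blk Σ B ∷ fm (A ≼ B) ∷ Δ) ∷ G)) →
    HDer X ((Γ , fm (A ≼ B) ∷ Δ) ∷ G)
  ≼R-unfold ps {A = A} w sides close =
    ≼R (exR (swap _ _ ↭-refl) (unfold-≼L ps [ A ] w sides close ↭-refl))

  copy-boxesˡ : hA X → ∀ L {Γ Δ Ω Θ G} → L ⊑ Γ →
    HDer X ((Γ , Δ) ∷ (boxes L ++ Ω , Θ) ∷ G) → HDer X ((Γ , Δ) ∷ (Ω , Θ) ∷ G)
  copy-boxesˡ h [] w d = d
  copy-boxesˡ h (atom _ ∷ L) w d = copy-boxesˡ h L (∷⊑⇒ w) d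
  copy-boxesˡ h (falsum ∷ L) w d = copy-boxesˡ h L (∷⊑⇒ w) d
  copy-boxesˡ h ((_ ⇒ _) ∷ L) w d = copy-boxesˡ h L (∷⊑⇒ w) d
  copy-boxesˡ h ((A ≼ B) ∷ L) {Ω = Ω} w d with ∷⊑-split w
  ... | _ , e = exL (↭-sym e) (AL h (exL e
    (copy-boxesˡ h L (∷⊑⇒ w) (exL₂ (↭-sym (shift (A ≼ B) (boxes L) Ω)) d))))

  copy-boxesʳ : hA X → ∀ L {Γ Δ Ω Θ G} → map fm L ⊑ Δ →
    HDer X ((Γ , Δ) ∷ (Ω , map fm (boxes L) ++ Θ) ∷ G) → HDer X ((Γ , Δ) ∷ (Ω , Θ) ∷ G)
  copy-boxesʳ h [] w d = d
  copy-boxesʳ h (atom _ ∷ L) w d = copy-boxesʳ h L (∷⊑⇒ w) d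
  copy-boxesʳ h (falsum ∷ L) w d = copy-boxesʳ h L (∷⊑⇒ w) d
  copy-boxesʳ h ((_ ⇒ _) ∷ L) w d = copy-boxesʳ h L (∷⊑⇒ w) d
  copy-boxesʳ h ((A ≼ B) ∷ L) {Θ = Θ} w d with ∷⊑-split w
  ... | _ , e = exR (↭-sym e) (AR h (exR e
    (copy-boxesʳ h L (∷⊑⇒ w) (exR₂ (↭-sym (shift (fm (A ≼ B)) (map fm (boxes L)) Θ)) d))))

  HDerᵂ-beside-boxes : hA X → ∀ {L D Π Π′ Ψ Ψ′ Γ Δ G} → L ⊑ Γ → map fm D ⊑ Δ →
    Π ⊑ boxes L ++ Π′ → Ψ ⊑ boxes D ++ Ψ′ → HDerᵂ (Π , Ψ) →
    HDer X ((Γ , Δ) ∷ (Π′ , map fm Ψ′) ∷ G)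
  HDerᵂ-beside-boxes h {L} {D} {Ψ′ = Ψ′} wL wD wΠ wΨ d =
    copy-boxesˡ h L wL (copy-boxesʳ h D wD (swap₁₂ (d wΠ
      (⊑-trans (⊑-map⁺ fm wΨ) (⊑-reflexive (↭-reflexive (Listₚ.map-++ fm (boxes D) Ψ′)))))))

  StairPremiss : Formula × List Formula → Set
  StairPremiss (C , l) = HDerᵂ ([ C ] , l)

  -- The pairs in pre have already been eliminated by T; the right premiss
  -- [⊥ ◁ C] of T for the next C ≼ D is closed by unfolding Σ^≼ of pre.
  T-unfold : hT X → ∀ ps pre {Γ Δ G} → Sig pre ++ Sig ps ⊑ Γ →
    All StairPremiss (stairs [] pre) → All StairPremiss (stairs (Ds pre) ps) →
    (∀ {Δ′} → map fm (Ds ps) ++ Δ ⊑ Δ′ → HDer X ((Γ , Δ′) ∷ G)) →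
    HDer X ((Γ , Δ) ∷ G)
  T-unfold h [] pre _ _ _ main = main ⊑-refl
  T-unfold h ((C , D) ∷ ps) pre {Γ} {Δ} {G} w done (dC ∷ todo) main
    with ∷⊑-split (++⊑⇒ʳ {xs = Sig pre} w)
  ... | _ , e = exL (↭-sym e) (Tr h (exL e left) (exL e right))
    where
    w′ : Sig (pre ++ [ (C , D) ]) ++ Sig ps ⊑ Γ
    w′ = ⊑-trans (⊑-reflexive (↭-reflexive (begin
      Sig (pre ++ [ (C , D) ]) ++ Sig ps      ≡⟨ cong (_++ Sig ps) (Listₚ.map-++ _ pre [ (C , D) ]) ⟩
      (Sig pre ++ [ C ≼ D ]) ++ Sig ps        ≡⟨ Listₚ.++-assoc (Sig pre) [ C ≼ D ] (Sig ps) ⟩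
      Sig pre ++ Sig ((C , D) ∷ ps)           ∎))) w
      where open ≡-Reasoning
    done′ : All StairPremiss (stairs [] (pre ++ [ (C , D) ]))
    done′ = subst (All StairPremiss) (sym (stairs-++ [] pre [ (C , D) ])) (Allₚ.++⁺ done (dC ∷ []))
    todo′ : All StairPremiss (stairs (Ds (pre ++ [ (C , D) ])) ps)
    todo′ = subst (λ acc → All StairPremiss (stairs acc ps)) (sym (Listₚ.map-++ proj₂ pre [ (C , D) ])) todo
    left : HDer X ((Γ , fm D ∷ Δ) ∷ G)
    left = T-unfold h ps (pre ++ [ (C , D) ]) w′ done′ todo′
      (λ v → main (⊑-trans (⊑-reflexive (↭-sym (shift (fm D) (map fm (Ds ps)) Δ))) v))
    right : HDer X ((Γ , blk [ falsum ] C ∷ Δ) ∷ G)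
    right = unfold-≼L pre [ falsum ] (++⊑⇒ˡ w)
      (All-stairs-∷ pre [] falsum (λ _ _ → HDerᵂ⇒SideDer (⊑-skip ⊑-refl)) done)
      (λ e′ → jp-HDerᵂ dC (⊑-trans (⊑-skip ⊑-refl) (⊑-reflexive (↭-sym e′))))
      ↭-refl

  CP-admissible : ∀ ps {Γ Δ A B} →
    All (λ q → HDerᵂ ([ proj₁ q ] , A ∷ proj₂ q)) (stairs [] ps) →
    HDerᵂ ([ B ] , A ∷ Ds ps) → HDerᵂ (Sig ps ++ Γ , (A ≼ B) ∷ Δ)
  CP-admissible ps {A = A} sides d wΓ wΔ = focusʳ wΔ λ _ →
    ≼R-unfold ps (++⊑⇒ˡ wΓ)
      (All-stairs-∷ ps [] A (λ _ _ → HDerᵂ⇒SideDer ⊑-refl) sides)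
      (λ e → jp-HDerᵂ d (⊑-reflexive (↭-sym e)))

  N-admissible : hN X → ∀ ps {Γ Δ} → All StairPremiss (stairs [] ps) →
    HDerᵂ ([] , Ds ps) → HDerᵂ (Sig ps ++ Γ , Δ)
  N-admissible h ps sides d wΓ wΔ =
    Nr h (unfold-≼L ps [ falsum ] (++⊑⇒ˡ wΓ)
      (All-stairs-∷ ps [] falsum (λ _ _ → HDerᵂ⇒SideDer (⊑-skip ⊑-refl)) sides)
      (λ e → jp-HDerᵂ (HDerᵂ-weaken []⊑ ⊑-refl d) (⊑-trans (⊑-skip ⊑-refl) (⊑-reflexive (↭-sym e))))
      ↭-refl)

  T-admissible : hT X → ∀ ps {Γ Δ} → All StairPremiss (stairs [] ps) →
    HDerᵂ (Sig ps ++ Γ , Ds ps ++ Δ) → HDerᵂ (Sig ps ++ Γ , Δ)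
  T-admissible h ps {Δ = Δ} sides d wΓ wΔ =
    T-unfold h ps [] (++⊑⇒ˡ wΓ) [] sides λ v →
      d wΓ (⊑-trans (⊑-reflexive (↭-reflexive (Listₚ.map-++ fm (Ds ps) Δ))) (⊑-trans (⊑-++⁺ ⊑-refl wΔ) v))

  W-admissible : hW X → ∀ ps {Γ Δ A B} →
    All (λ q → HDerᵂ ([ proj₁ q ] , A ∷ proj₂ q)) (stairs [] ps) →
    HDerᵂ (Sig ps ++ Γ , A ∷ (A ≼ B) ∷ Ds ps ++ Δ) → HDerᵂ (Sig ps ++ Γ , (A ≼ B) ∷ Δ)
  W-admissible h ps {Δ = Δ} {A} {B} sides d wΓ wΔ = focusʳ wΔ λ w →
    ≼R-unfold ps (++⊑⇒ˡ wΓ)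
      (All-stairs-∷ ps [] A (λ _ _ → HDerᵂ⇒SideDer ⊑-refl) sides)
      (λ e → Wr h (HDerᵂ-weaken ⊑-refl (⊑-reflexive reorder) d wΓ
        (⊑-skip (⊑-trans (⊑-reflexive (↭-reflexive (Listₚ.map-++ fm (A ∷ Ds ps) ((A ≼ B) ∷ Δ))))
                          (⊑-++⁺ (⊑-map⁺ fm (⊑-reflexive (↭-sym e))) (∷⁺ w))))))
    where
    reorder : A ∷ (A ≼ B) ∷ Ds ps ++ Δ ↭ (A ∷ Ds ps) ++ (A ≼ B) ∷ Δ
    reorder = prep A (↭-sym (shift (A ≼ B) (Ds ps) Δ))

  W0-admissible : hW X → ∀ {Γ Δ A B} →
    HDerᵂ (Γ , (A ≼ B) ∷ A ∷ Δ) → HDerᵂ (Γ , (A ≼ B) ∷ Δ)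
  W0-admissible h d wΓ wΔ = focusʳ wΔ λ w →
    ≼R (exR (swap _ _ ↭-refl) (Wr h
      (d wΓ (⊑-skip (⊑-trans (∷⁺ (∷⁺ w)) (⊑-reflexive (swap _ _ ↭-refl)))))))

  C0-admissible : hC X → ∀ {Γ Δ A B} →
    HDerᵂ ((A ≼ B) ∷ A ∷ Γ , Δ) → HDerᵂ ((A ≼ B) ∷ Γ , B ∷ Δ) → HDerᵂ ((A ≼ B) ∷ Γ , Δ)
  C0-admissible h d₁ d₂ wΓ wΔ = focusˡ wΓ λ w → Cr h (d₂ (∷⁺ w) (∷⁺ wΔ)) (d₁ (∷⁺ (∷⁺ w)) wΔ)

  A-admissible : hA X → ∀ ps {Γ Δ A B} →
    All (λ q → HDerᵂ (boxes Γ ++ Sig ps ++ [ proj₁ q ] , (A ≼ B) ∷ A ∷ proj₂ q ++ boxes Δ))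
        (stairs [] ps) →
    HDerᵂ (boxes Γ ++ Sig ps ++ [ B ] , (A ≼ B) ∷ A ∷ Ds ps ++ boxes Δ) →
    HDerᵂ (Sig ps ++ Γ , (A ≼ B) ∷ Δ)
  A-admissible h ps {Γ} {Δ} {A} {B} sides d {G} {Γ₁} wΓ wΔ = focusʳ wΔ λ w →
    ≼R-unfold ps (++⊑⇒ˡ wΓ)
      (All-stairs-∷ ps [] A
        {P = λ q → HDerᵂ (boxes Γ ++ Sig ps ++ [ proj₁ q ] , (A ≼ B) ∷ A ∷ proj₂ q ++ boxes Δ)}
        (λ C l dC v → beside (⊑-trans (∷⁺ w) v) C (reorder (A ∷ l)) dC) sides)
      (λ e → jp (beside (⊑-skip (∷⁺ w)) B
        (⊑-trans (reorder (A ∷ Ds ps)) (⊑-++⁺ (⊑-refl {xs = (A ≼ B) ∷ boxes Δ}) (⊑-reflexive (↭-sym e)))) d))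
    where
    reorder : ∀ M → (A ≼ B) ∷ M ++ boxes Δ ⊑ boxes ((A ≼ B) ∷ Δ) ++ M
    reorder M = ⊑-reflexive (prep (A ≼ B) (++-comm M (boxes Δ)))
    beside : ∀ {Δ′ Ψ Ψ′} → map fm ((A ≼ B) ∷ Δ) ⊑ Δ′ → ∀ C → Ψ ⊑ boxes ((A ≼ B) ∷ Δ) ++ Ψ′ →
      HDerᵂ (boxes Γ ++ Sig ps ++ [ C ] , Ψ) → HDer X ((Γ₁ , Δ′) ∷ ([ C ] , map fm Ψ′) ∷ G)
    beside v C = HDerᵂ-beside-boxes h {L = Sig ps ++ Γ} wΓ v (⊑-reflexive (boxes-Sig-++-∷ʳ Γ ps C))

  NA-admissible : hN X → hA X → ∀ ps {Γ Δ} →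
    All (λ q → HDerᵂ (boxes Γ ++ Sig ps ++ [ proj₁ q ] , proj₂ q ++ boxes Δ)) (stairs [] ps) →
    HDerᵂ (boxes Γ ++ Sig ps , Ds ps ++ boxes Δ) → HDerᵂ (Sig ps ++ Γ , Δ)
  NA-admissible hasN hasA ps {Γ} {Δ} sides d {G} {Γ₁} wΓ wΔ =
    Nr hasN (unfold-≼L ps [ falsum ] (++⊑⇒ˡ wΓ)
      (All-stairs-∷ ps [] falsum
        {P = λ q → HDerᵂ (boxes Γ ++ Sig ps ++ [ proj₁ q ] , proj₂ q ++ boxes Δ)}
        (λ C l dC v → beside (⊑-trans wΔ v) (⊑-reflexive (boxes-Sig-++-∷ʳ Γ ps C)) (reorder l (⊑-skip ⊑-refl)) dC)
        sides)
      (λ e → jp (beside (⊑-skip wΔ)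
        (⊑-trans (⊑-reflexive (boxes-Sig-++ Γ ps)) (⊑-extend [ verum ]))
        (reorder (Ds ps) (⊑-trans (⊑-skip ⊑-refl) (⊑-reflexive (↭-sym e)))) d))
      ↭-refl)
    where
    reorder : ∀ {M′} M → M ⊑ M′ → M ++ boxes Δ ⊑ boxes Δ ++ M′
    reorder M w = ⊑-trans (⊑-reflexive (++-comm M (boxes Δ))) (⊑-++⁺ ⊑-refl w)
    beside : ∀ {Δ′ Π Π′ Ψ Ψ′} → map fm Δ ⊑ Δ′ → Π ⊑ boxes (Sig ps ++ Γ) ++ Π′ → Ψ ⊑ boxes Δ ++ Ψ′ →
      HDerᵂ (Π , Ψ) → HDer X ((Γ₁ , Δ′) ∷ (Π′ , map fm Ψ′) ∷ G)
    beside = HDerᵂ-beside-boxes hasA {L = Sig ps ++ Γ} wΓ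

  mutual
    translate : ∀ {s} → GDer X s → HDerᵂ s
    translate (exG p q d) wΓ wΔ = HDerᵂ-weaken (⊑-reflexive p) (⊑-reflexive q) (translate d) wΓ wΔ
    translate init wΓ wΔ = focusˡ wΓ λ _ → focusʳ wΔ λ _ → init
    translate botL wΓ wΔ = focusˡ wΓ λ _ → botL
    translate (impL d₁ d₂) wΓ wΔ = focusˡ wΓ λ w →
      impL (translate d₂ (⊑-skip (∷⁺ w)) wΔ) (translate d₁ (⊑-skip w) (∷⁺ wΔ))
    translate (impR d) wΓ wΔ = focusʳ wΔ λ w → impR (translate d (∷⁺ wΓ) (⊑-skip (∷⁺ w)))
    translate (CP ps _ sides d) wΓ wΔ = CP-admissible ps (translate-All sides) (translate d) wΓ wΔ
    translate (Nn p ps g sides d) wΓ wΔ =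
      N-admissible (gN⇒hN g) (p ∷ ps) (translate-All sides) (translate d) wΓ wΔ
    translate (Tn p ps g sides d) wΓ wΔ =
      T-admissible (gT⇒hT g) (p ∷ ps) (translate-All sides) (translate d) wΓ wΔ
    translate (Wn ps g sides d) wΓ wΔ = W-admissible (gW⇒hW g) ps (translate-All sides) (translate d) wΓ wΔ
    translate (W0 g d) wΓ wΔ = W0-admissible (gW0⇒hW g) (translate d) wΓ wΔ
    translate (C0 g d₁ d₂) wΓ wΔ = C0-admissible (gC0⇒hC g) (translate d₁) (translate d₂) wΓ wΔ
    translate (An ps g sides d) wΓ wΔ = A-admissible (gA⇒hA g) ps (translate-All sides) (translate d) wΓ wΔ
    translate (NAn p ps g sides d) wΓ wΔ =
      NA-admissible (gNA⇒hN g) (gNA⇒hA g) (p ∷ ps) (translate-All sides) (translate d) wΓ wΔ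

    translate-All : ∀ {I : Set} {f : I → Sequent} {is} →
      All (λ i → GDer X (f i)) is → All (λ i → HDerᵂ (f i)) is
    translate-All [] = []
    translate-All (d ∷ ds) = translate d ∷ translate-All ds

theorem5p4 : (X : Ext) (A : Formula) →
    GDer X ([] , [ A ]) → HDer X [ ([] , [ fm A ]) ]
theorem5p4 X A d = Translation.translate X d ⊑-refl ⊑-refl
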